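{- Let $k\ge 9$ be an integer and let $r,s$ be distinct elements of $\mathbb{Z}_{2k}$ such that $T_1(k,r,s)$ is a connected simple graph. If $3r-s\equiv 0 \pmod{2k}$, then $T_1(k,r,s)$ is not vertex-transitive.
   Context: $T_1(k,r,s)$ is the graph with vertex set $\{u_i,v_i,w_i: i\in\mathbb{Z}_{2k}\}$ and edges $u_iu_{i+k}$, $u_iv_i$, $u_iw_i$, $v_iw_{i+r}$, $v_iw_{i+s}$ ($i\in\mathbb{Z}_{2k}$). -}

module Defs where

open import Data.Nat using (ℕ; _+_; _*_)
open import Data.Fin using (Fin; toℕ)
open import Data.Sum using (_⊎_)
open import Data.Product using (Σ; _×_)
open import Function.Bundles using (_↔_; Inverse; _⇔_)
open import Relation.Binary.PropositionalEquality using (_≡_)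
open import Relation.Binary.Construct.Closure.ReflexiveTransitive using (Star)

-- Z_n is Fin n.  For i j : Fin n and a natural c < n,
-- "i + c = j in Z_n" holds iff toℕ i + c is toℕ j or toℕ j + n
-- (exact, since toℕ i + c < 2n).
AddEq : (n : ℕ) → Fin n → ℕ → Fin n → Set
AddEq n i c j = (toℕ i + c ≡ toℕ j) ⊎ (toℕ i + c ≡ toℕ j + n)

data Vertex (k : ℕ) : Set where
  u v w : Fin (2 * k) → Vertex k

data Edge (k : ℕ) (r s : Fin (2 * k)) : Vertex k → Vertex k → Set where
  uu  : ∀ i j → AddEq (2 * k) i k j → Edge k r s (u i) (u j)
  uv  : ∀ i → Edge k r s (u i) (v i)
  uw  : ∀ i → Edge k r s (u i) (w i)
  vwr : ∀ i j → AddEq (2 * k) i (toℕ r) j → Edge k r s (v i) (w j)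
  vws : ∀ i j → AddEq (2 * k) i (toℕ s) j → Edge k r s (v i) (w j)

Adj : (k : ℕ) → Fin (2 * k) → Fin (2 * k) → Vertex k → Vertex k → Set
Adj k r s x y = Edge k r s x y ⊎ Edge k r s y x

Connected : (k : ℕ) → Fin (2 * k) → Fin (2 * k) → Set
Connected k r s = ∀ x y → Star (Adj k r s) x y

IsAutomorphism : (k : ℕ) → Fin (2 * k) → Fin (2 * k) → (Vertex k ↔ Vertex k) → Set
IsAutomorphism k r s σ = ∀ x y → Adj k r s x y ⇔ Adj k r s (Inverse.to σ x) (Inverse.to σ y)

VertexTransitive : (k : ℕ) → Fin (2 * k) → Fin (2 * k) → Set
VertexTransitive k r s =
  ∀ x y → Σ (Vertex k ↔ Vertex k) (λ σ → IsAutomorphism k r s σ × (Inverse.to σ x ≡ y))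

module Submission where

-- Connectivity forces gcd(k, r) = 1 (connected⇒coprime).  As s ≡ 3r, every
-- index reached from i along edges is i + a·k + b·r: a u–u edge changes the
-- k-coordinate a by ±1, and a v–w edge (a "spoke") changes the r-coordinate b
-- by ±1 or ±3 (module Geometry, relation At).  Since gcd(k, r) = 1 and k ≥ 9,
-- two coordinate pairs whose b's differ by a nonzero amount of size at most 8
-- never name the same index (no-short-relation).
--
-- Call a vertex good if every 3-arc at it (a non-backtracking walk of length
-- 3) extends to an "octagon", a closed non-backtracking walk of length 8
-- (module Walks); goodness is invariant under automorphisms.  Every u_i is
-- good, by explicit octagons (u-arcs-close).  No v_i is good: closing the arc
-- v_i u_i u_{i+k} w_{i+k} means returning from coordinates (1,0) to (0,0) in
-- five steps, which forces such a short relation (v-arc-open).  So no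
-- automorphism maps v_i to u_i.

open import Defs
open import Data.Nat using (ℕ; _≤_; _*_; _+_)
open import Data.Fin using (Fin; toℕ)
open import Data.Product using (∃)
open import Relation.Binary.PropositionalEquality using (_≡_; _≢_)
open import Relation.Nullary using (¬_)

import Data.Nat as ℕ
open import Data.Nat using (NonZero; zero; suc; z≤n; s≤s; _<_; _∸_; _⊔_; _<?_; _≤ᵇ_)
import Data.Nat.Properties as ℕₚ
open import Data.Nat.Divisibility as ℕ∣ using () renaming (_∣_ to _∣ℕ_)
open import Data.Integer using (ℤ; +_; -[1+_]; 0ℤ; 1ℤ; ∣_∣; _⊖_)
  renaming (_+_ to _+ℤ_; _-_ to _-ℤ_; _*_ to _*ℤ_; -_ to -ℤ_)
import Data.Integer.Properties as ℤₚ
open import Data.Integer.Divisibility.Signed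
  using (divides; ∣-refl; ∣-trans; ∣m∣n⇒∣m+n; ∣m∣n⇒∣m-n; ∣m+n∣m⇒∣n; ∣n⇒∣m*n; ∣m⇒∣-m; ∣⇒∣ᵤ)
  renaming (_∣_ to _∣ℤ_)
open import Data.Integer.DivMod using (_%ℕ_; _/ℕ_; n%ℕd<d; a≡a%ℕn+[a/ℕn]*n)
open import Data.Integer.Tactic.RingSolver using (solve-∀)
open import Data.Fin using (fromℕ<)
open import Data.Fin.Properties using (toℕ<n; toℕ-fromℕ<; toℕ-injective)
open import Data.Sum using (inj₁; inj₂)
open import Data.Product using (_,_; _×_; proj₁; proj₂)
open import Data.Bool using (Bool; T; _∧_)
open import Data.Bool.Properties using (T-∧)
open import Data.Unit using (tt)
open import Data.Empty using (⊥; ⊥-elim)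
open import Relation.Nullary using (yes; no)
open import Relation.Binary.Bundles using (Setoid)
open import Relation.Binary.PropositionalEquality using (refl; sym; trans; cong; subst; module ≡-Reasoning)
import Relation.Binary.Reasoning.Setoid
open import Level using (0ℓ)
open import Function using (_∘_; id)
open import Relation.Binary.Construct.Closure.ReflexiveTransitive using (Star; fold)
open import Data.Nat.Coprimality using (Coprime; coprime-divisor)
open import Function.Bundles using (_↔_; _⇔_; mk⇔; Inverse; Injection; Equivalence)
open import Function.Properties.Inverse using (↔⇒↣)

module Congruence (n : ℕ) where

  -- x ≈ y : n divides x - y (a record, so that x and y can be inferred)
  infix 4 _≈_
  record _≈_ (x y : ℤ) : Set where
    constructor ⟨_⟩
    field n∣x-y : + n ∣ℤ (x -ℤ y)

  ≈-reflexive : ∀ {x y} → x ≡ y → x ≈ y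
  ≈-reflexive {x} refl = ⟨ subst (+ n ∣ℤ_) (sym (ℤₚ.+-inverseʳ x)) (divides 0ℤ refl) ⟩

  ≈-refl : ∀ {x} → x ≈ x
  ≈-refl = ≈-reflexive refl

  ≈-sym : ∀ {x y} → x ≈ y → y ≈ x
  ≈-sym {x} {y} ⟨ x≈y ⟩ = ⟨ subst (+ n ∣ℤ_) (negate x y) (∣m⇒∣-m x≈y) ⟩
    where
    negate : ∀ x y → -ℤ (x -ℤ y) ≡ y -ℤ x
    negate = solve-∀

  ≈-trans : ∀ {x y z} → x ≈ y → y ≈ z → x ≈ z
  ≈-trans {x} {y} {z} ⟨ x≈y ⟩ ⟨ y≈z ⟩ = ⟨ subst (+ n ∣ℤ_) (telescope x y z) (∣m∣n⇒∣m+n x≈y y≈z) ⟩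
    where
    telescope : ∀ x y z → (x -ℤ y) +ℤ (y -ℤ z) ≡ x -ℤ z
    telescope = solve-∀

  ≈-setoid : Setoid 0ℓ 0ℓ
  ≈-setoid = record { isEquivalence = record { refl = λ {x} → ≈-refl {x} ; sym = ≈-sym ; trans = ≈-trans } }

  module ≈-Reasoning = Relation.Binary.Reasoning.Setoid ≈-setoid

  +-cong : ∀ {x x′ y y′} → x ≈ x′ → y ≈ y′ → x +ℤ y ≈ x′ +ℤ y′
  +-cong {x} {x′} {y} {y′} ⟨ x≈x′ ⟩ ⟨ y≈y′ ⟩ =
    ⟨ subst (+ n ∣ℤ_) (regroup x x′ y y′) (∣m∣n⇒∣m+n x≈x′ y≈y′) ⟩
    where
    regroup : ∀ x x′ y y′ → (x -ℤ x′) +ℤ (y -ℤ y′) ≡ (x +ℤ y) -ℤ (x′ +ℤ y′)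
    regroup = solve-∀

  +-congˡ : ∀ x {y y′} → y ≈ y′ → x +ℤ y ≈ x +ℤ y′
  +-congˡ x = +-cong (≈-refl {x})

  +-congʳ : ∀ {x x′} y → x ≈ x′ → x +ℤ y ≈ x′ +ℤ y
  +-congʳ y x≈x′ = +-cong x≈x′ (≈-refl {y})

  +-cancelʳ : ∀ {x y} d → x +ℤ d ≈ y +ℤ d → x ≈ y
  +-cancelʳ {x} {y} d ⟨ n∣x+d-y-d ⟩ = ⟨ subst (+ n ∣ℤ_) (cancel x y d) n∣x+d-y-d ⟩
    where
    cancel : ∀ x y d → (x +ℤ d) -ℤ (y +ℤ d) ≡ x -ℤ y
    cancel = solve-∀

  +-multiple : ∀ x m → x +ℤ m *ℤ + n ≈ x
  +-multiple x m = ⟨ subst (+ n ∣ℤ_) (cancel x m (+ n)) (divides m refl) ⟩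
    where
    cancel : ∀ x m n → m *ℤ n ≡ (x +ℤ m *ℤ n) -ℤ x
    cancel = solve-∀

  n≈0 : + n ≈ 0ℤ
  n≈0 = ⟨ divides 1ℤ (minus-zero (+ n)) ⟩
    where
    minus-zero : ∀ x → x -ℤ 0ℤ ≡ 1ℤ *ℤ x
    minus-zero = solve-∀

  +n≈ : ∀ x → x +ℤ + n ≈ x
  +n≈ x = ≈-trans (+-congˡ x n≈0) (≈-reflexive (ℤₚ.+-identityʳ x))

  ∸n-preserves : ∀ {m} → n ≤ m → + (m ∸ n) ≈ + m
  ∸n-preserves {m} n≤m = ≈-sym (begin
    + m                          ≡⟨ cong +_ (sym (ℕₚ.m∸n+n≡m n≤m)) ⟩
    + (m ∸ n + n)                ≡⟨ ℤₚ.pos-+ (m ∸ n) n ⟩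
    + (m ∸ n) +ℤ + n             ≈⟨ +n≈ (+ (m ∸ n)) ⟩
    + (m ∸ n)                    ∎)
    where open ≈-Reasoning

  ℕ-≈ : ∀ {a b} q → a ≡ b + q * n → + a ≈ + b
  ℕ-≈ {a} {b} q a≡b+qn = ≈-trans (≈-reflexive (begin
    + a                   ≡⟨ cong +_ a≡b+qn ⟩
    + (b + q * n)         ≡⟨ ℤₚ.pos-+ b (q * n) ⟩
    + b +ℤ + (q * n)      ≡⟨ cong (+ b +ℤ_) (ℤₚ.pos-* q n) ⟩
    + b +ℤ + q *ℤ + n     ∎)) (+-multiple (+ b) (+ q))
    where open ≡-Reasoning

  ι : Fin n → ℤ
  ι i = + toℕ i

  small-multiple : ∀ {m} → n ∣ℕ m → m < n → m ≡ 0
  small-multiple {zero}  _   _   = refl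
  small-multiple {suc m} n∣m m<n = ⊥-elim (ℕ∣.>⇒∤ m<n n∣m)

  ι-injective : ∀ {i j} → ι i ≈ ι j → i ≡ j
  ι-injective {i} {j} ⟨ n∣i-j ⟩ =
    toℕ-injective (ℤₚ.+-injective (ℤₚ.i-j≡0⇒i≡j (ι i) (ι j) (ℤₚ.∣i∣≡0⇒i≡0 distance≡0)))
    where
    open ℕₚ.≤-Reasoning
    distance<n : ∣ ι i -ℤ ι j ∣ < n
    distance<n = begin-strict
      ∣ ι i -ℤ ι j ∣      ≡⟨ cong ∣_∣ (ℤₚ.[+m]-[+n]≡m⊖n (toℕ i) (toℕ j)) ⟩
      ∣ toℕ i ⊖ toℕ j ∣  ≤⟨ ℤₚ.∣m⊝n∣≤m⊔n (toℕ i) (toℕ j) ⟩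
      toℕ i ⊔ toℕ j      <⟨ ℕₚ.⊔-lub (toℕ<n i) (toℕ<n j) ⟩
      n                  ∎
    distance≡0 : ∣ ι i -ℤ ι j ∣ ≡ 0
    distance≡0 = small-multiple (∣⇒∣ᵤ n∣i-j) distance<n

  AddEq⇒≈ : ∀ {i c j} → AddEq n i c j → ι j ≈ ι i +ℤ + c
  AddEq⇒≈ {i} {c} {j} (inj₁ i+c≡j) =
    ≈-reflexive (trans (cong +_ (sym i+c≡j)) (ℤₚ.pos-+ (toℕ i) c))
  AddEq⇒≈ {i} {c} {j} (inj₂ i+c≡j+n) = ≈-sym (begin
    ι i +ℤ + c            ≡⟨ trans (sym (ℤₚ.pos-+ (toℕ i) c)) (cong +_ i+c≡j+n) ⟩
    + (toℕ j + n)         ≡⟨ ℤₚ.pos-+ (toℕ j) n ⟩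
    ι j +ℤ + n            ≈⟨ +n≈ (ι j) ⟩
    ι j                   ∎)
    where open ≈-Reasoning

  represents : ∀ {m j} (m<n : m < n) → ι j ≈ + m → toℕ j ≡ m
  represents m<n j≈m =
    trans (cong toℕ (ι-injective (≈-trans j≈m (≈-reflexive (cong +_ (sym (toℕ-fromℕ< m<n)))))))
          (toℕ-fromℕ< m<n)

  AddEq-injective : ∀ {i i′} c j → AddEq n i c j → AddEq n i′ c j → i ≡ i′
  AddEq-injective {i} {i′} c j e e′ =
    ι-injective (+-cancelʳ (+ c) (≈-trans (≈-sym (AddEq⇒≈ {i} {c} {j} e)) (AddEq⇒≈ {i′} {c} {j} e′)))

  AddEq-functional : ∀ {j j′} i c → AddEq n i c j → AddEq n i c j′ → j ≡ j′
  AddEq-functional {j} {j′} i c e e′ =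
    ι-injective (≈-trans (AddEq⇒≈ {i} {c} {j} e) (≈-sym (AddEq⇒≈ {i} {c} {j′} e′)))

  module _ {{_ : NonZero n}} where

    reduce : (z : ℤ) → ∃ λ j → ι j ≈ z
    reduce z = fromℕ< (n%ℕd<d z n) , ≈-sym (begin
      z                                    ≡⟨ a≡a%ℕn+[a/ℕn]*n z n ⟩
      + (z %ℕ n) +ℤ (z /ℕ n) *ℤ + n        ≈⟨ +-multiple (+ (z %ℕ n)) (z /ℕ n) ⟩
      + (z %ℕ n)                           ≡⟨ cong +_ (sym (toℕ-fromℕ< (n%ℕd<d z n))) ⟩
      ι (fromℕ< (n%ℕd<d z n))              ∎)
      where open ≈-Reasoning

    ≈⇒AddEq : ∀ {i c j} → c < n → ι j ≈ ι i +ℤ + c → AddEq n i c j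
    ≈⇒AddEq {i} {c} {j} c<n j≈i+c with toℕ i + c <? n
    ... | yes m<n = inj₁ (sym (represents m<n (≈-trans j≈i+c (≈-reflexive (sym (ℤₚ.pos-+ (toℕ i) c))))))
    ... | no  m≮n = inj₂ (begin
      toℕ i + c              ≡⟨ sym (ℕₚ.m∸n+n≡m n≤m) ⟩
      toℕ i + c ∸ n + n      ≡⟨ cong (_+ n) (sym (represents m∸n<n j≈m∸n)) ⟩
      toℕ j + n              ∎)
      where
      open ≡-Reasoning
      n≤m : n ≤ toℕ i + c
      n≤m = ℕₚ.≮⇒≥ m≮n
      m∸n<n : toℕ i + c ∸ n < n
      m∸n<n = ℕₚ.m<n+o⇒m∸n<o (toℕ i + c) n (ℕₚ.+-mono-< (toℕ<n i) c<n)
      j≈m∸n : ι j ≈ + (toℕ i + c ∸ n)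
      j≈m∸n = ≈-trans j≈i+c (≈-trans (≈-reflexive (sym (ℤₚ.pos-+ (toℕ i) c))) (≈-sym (∸n-preserves n≤m)))

module Walks {V : Set} (_~_ : V → V → Set) where

  record Arc (y₀ y₁ y₂ y₃ : V) : Set where
    field
      a01 : y₀ ~ y₁
      a12 : y₁ ~ y₂
      a23 : y₂ ~ y₃
      d02 : y₀ ≢ y₂
      d13 : y₁ ≢ y₃

  record Octagon (y₀ y₁ y₂ y₃ y₄ y₅ y₆ y₇ : V) : Set where
    field
      a01 : y₀ ~ y₁
      a12 : y₁ ~ y₂
      a23 : y₂ ~ y₃
      a34 : y₃ ~ y₄
      a45 : y₄ ~ y₅
      a56 : y₅ ~ y₆
      a67 : y₆ ~ y₇
      a70 : y₇ ~ y₀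
      d02 : y₀ ≢ y₂
      d13 : y₁ ≢ y₃
      d24 : y₂ ≢ y₄
      d35 : y₃ ≢ y₅
      d46 : y₄ ≢ y₆
      d57 : y₅ ≢ y₇
      d60 : y₆ ≢ y₀
      d71 : y₇ ≢ y₁

  Closes : V → V → V → V → Set
  Closes y₀ y₁ y₂ y₃ =
    ∃ λ y₄ → ∃ λ y₅ → ∃ λ y₆ → ∃ λ y₇ → Octagon y₀ y₁ y₂ y₃ y₄ y₅ y₆ y₇

  ArcsClose : V → Set
  ArcsClose x = ∀ {y₁ y₂ y₃} → Arc x y₁ y₂ y₃ → Closes x y₁ y₂ y₃

  octagon-reflect : (f : V → V) → (∀ {x y} → f x ~ f y → x ~ y) →
    ∀ {y₀ y₁ y₂ y₃ y₄ y₅ y₆ y₇ z₀ z₁ z₂ z₃ z₄ z₅ z₆ z₇} →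
    f y₀ ≡ z₀ → f y₁ ≡ z₁ → f y₂ ≡ z₂ → f y₃ ≡ z₃ →
    f y₄ ≡ z₄ → f y₅ ≡ z₅ → f y₆ ≡ z₆ → f y₇ ≡ z₇ →
    Octagon z₀ z₁ z₂ z₃ z₄ z₅ z₆ z₇ → Octagon y₀ y₁ y₂ y₃ y₄ y₅ y₆ y₇
  octagon-reflect f reflect refl refl refl refl refl refl refl refl o = record
    { a01 = reflect a01 ; a12 = reflect a12 ; a23 = reflect a23 ; a34 = reflect a34
    ; a45 = reflect a45 ; a56 = reflect a56 ; a67 = reflect a67 ; a70 = reflect a70
    ; d02 = d02 ∘ cong f ; d13 = d13 ∘ cong f ; d24 = d24 ∘ cong f ; d35 = d35 ∘ cong f
    ; d46 = d46 ∘ cong f ; d57 = d57 ∘ cong f ; d60 = d60 ∘ cong f ; d71 = d71 ∘ cong f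
    }
    where open Octagon o

  -- ArcsClose is invariant under graph automorphisms: an arc at x is mapped
  -- forward to an arc at σ x, closed there, and the octagon is pulled back.
  module _ (σ : V ↔ V) (preserves : ∀ x y → (x ~ y) ⇔ (Inverse.to σ x ~ Inverse.to σ y)) where
    open Inverse σ using (to; from; strictlyInverseˡ)
    open Injection (↔⇒↣ σ) using (injective)

    arc-forward : ∀ {y₀ y₁ y₂ y₃} → Arc y₀ y₁ y₂ y₃ → Arc (to y₀) (to y₁) (to y₂) (to y₃)
    arc-forward arc = record
      { a01 = forward a01 ; a12 = forward a12 ; a23 = forward a23
      ; d02 = d02 ∘ injective ; d13 = d13 ∘ injective }
      where
      open Arc arc
      forward : ∀ {x y} → x ~ y → to x ~ to y
      forward {x} {y} = Equivalence.to (preserves x y)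

    arcsClose-reflect : ∀ x → ArcsClose (to x) → ArcsClose x
    arcsClose-reflect x closesAtσx arc with closesAtσx (arc-forward arc)
    ... | z₄ , z₅ , z₆ , z₇ , octagon =
      from z₄ , from z₅ , from z₆ , from z₇ ,
      octagon-reflect to (λ {x} {y} → Equivalence.from (preserves x y))
        refl refl refl refl (strictlyInverseˡ z₄) (strictlyInverseˡ z₅)
        (strictlyInverseˡ z₆) (strictlyInverseˡ z₇) octagon

index : ∀ {k} → Vertex k → Fin (2 * k)
index (u i) = i
index (v i) = i
index (w i) = i

∣m+n∣n⇒∣m : ∀ {d m o} → d ∣ℕ m + o → d ∣ℕ o → d ∣ℕ m
∣m+n∣n⇒∣m {d} {m} {o} d∣m+o = ℕ∣.∣m+n∣m⇒∣n (subst (d ∣ℕ_) (ℕₚ.+-comm m o) d∣m+o)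

AddEq-∣ : ∀ {n d c i j} → d ∣ℕ n → d ∣ℕ c → AddEq n i c j → (d ∣ℕ toℕ i) ⇔ (d ∣ℕ toℕ j)
AddEq-∣ {n} {d} {c} {i} {j} d∣n d∣c (inj₁ i+c≡j) = mk⇔
  (λ d∣i → subst (d ∣ℕ_) i+c≡j (ℕ∣.∣m∣n⇒∣m+n d∣i d∣c))
  (λ d∣j → ∣m+n∣n⇒∣m (subst (d ∣ℕ_) (sym i+c≡j) d∣j) d∣c)
AddEq-∣ {n} {d} {c} {i} {j} d∣n d∣c (inj₂ i+c≡j+n) = mk⇔
  (λ d∣i → ∣m+n∣n⇒∣m (subst (d ∣ℕ_) i+c≡j+n (ℕ∣.∣m∣n⇒∣m+n d∣i d∣c)) d∣n)
  (λ d∣j → ∣m+n∣n⇒∣m (subst (d ∣ℕ_) (sym i+c≡j+n) (ℕ∣.∣m∣n⇒∣m+n d∣j d∣n)) d∣c)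

-- In a connected T₁(k,r,s) with s ≡ 3r (mod 2k) we have gcd(k, r) = 1: a common
-- divisor d of k and r also divides 2k and s, so by AddEq-∣ the vertices whose
-- index is divisible by d are closed under adjacency; u₀ is one of them, hence
-- so is u₁, i.e. d ∣ 1.
connected⇒coprime : ∀ k {{_ : NonZero k}} (r s : Fin (2 * k)) q →
  3 * toℕ r ≡ toℕ s + q * (2 * k) → Connected k r s → Coprime k (toℕ r)
connected⇒coprime k r s q 3r≡s+qn connected {d} (d∣k , d∣r) =
  ℕ∣.∣1⇒≡1 (subst (d ∣ℕ_) (toℕ-fromℕ< 1<n)
    (reachable (connected (u (fromℕ< 0<n)) (u (fromℕ< 1<n)))
               (subst (d ∣ℕ_) (sym (toℕ-fromℕ< 0<n)) (d ℕ∣.∣0))))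
  where
  1<n : 1 < 2 * k
  1<n = ℕₚ.*-monoʳ-≤ 2 (ℕ.>-nonZero⁻¹ k)
  0<n : 0 < 2 * k
  0<n = ℕₚ.<-trans (s≤s z≤n) 1<n
  d∣n : d ∣ℕ 2 * k
  d∣n = ℕ∣.∣n⇒∣m*n 2 d∣k
  d∣s : d ∣ℕ toℕ s
  d∣s = ∣m+n∣n⇒∣m (subst (d ∣ℕ_) 3r≡s+qn (ℕ∣.∣n⇒∣m*n 3 d∣r)) (ℕ∣.∣n⇒∣m*n q d∣n)
  Divisible : Vertex k → Set
  Divisible x = d ∣ℕ toℕ (index x)
  edge : ∀ {x y} → Edge k r s x y → Divisible x ⇔ Divisible y
  edge (uu i j e)  = AddEq-∣ d∣n d∣k e
  edge (uv i)      = mk⇔ id id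
  edge (uw i)      = mk⇔ id id
  edge (vwr i j e) = AddEq-∣ d∣n d∣r e
  edge (vws i j e) = AddEq-∣ d∣n d∣s e
  step : ∀ {x y} → Adj k r s x y → Divisible x → Divisible y
  step (inj₁ e) = Equivalence.to (edge e)
  step (inj₂ e) = Equivalence.from (edge e)
  reachable : ∀ {x y} → Star (Adj k r s) x y → Divisible x → Divisible y
  reachable = fold (λ x y → Divisible x → Divisible y) (λ x~y f → f ∘ step x~y) id

module Geometry (k : ℕ) {{_ : NonZero k}} (9≤k : 9 ≤ k) (r s : Fin (2 * k))
  (coprime : Coprime k (toℕ r))
  (s≈3r : Congruence._≈_ (2 * k) (+ toℕ s) (+ 3 *ℤ + toℕ r)) where

  n : ℕ
  n = 2 * k

  instance
    n≢0 : NonZero n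
    n≢0 = ℕₚ.m*n≢0 2 k

  open Congruence n

  K R : ℤ
  K = + k
  R = ι r

  -- 2k ≡ 0: the k-coordinate only matters modulo 2
  2k≈0 : + 2 *ℤ K ≈ 0ℤ
  2k≈0 = ≈-trans (≈-reflexive (sym (ℤₚ.pos-* 2 k))) n≈0

  -- x lies at coordinates (a, b) relative to i when x ≡ i + a·k + b·r (mod 2k)
  offset : ℤ → ℤ → ℤ
  offset a b = a *ℤ K +ℤ b *ℤ R

  record At (i : Fin n) (a b : ℤ) (x : Fin n) : Set where
    constructor at
    field position : ι x ≈ ι i +ℤ offset a b

  at-origin : ∀ i → At i 0ℤ 0ℤ i
  at-origin i = at (≈-reflexive (offset0 (ι i) K R))
    where
    offset0 : ∀ x K R → x ≡ x +ℤ (0ℤ *ℤ K +ℤ 0ℤ *ℤ R)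
    offset0 = solve-∀

  point : Fin n → ℤ → ℤ → Fin n
  point i a b = proj₁ (reduce (ι i +ℤ offset a b))

  at-point : ∀ i a b → At i a b (point i a b)
  at-point i a b = at (proj₂ (reduce (ι i +ℤ offset a b)))

  At-step : ∀ {i a b a′ b′ x y} d → At i a b x → ι y ≈ ι x +ℤ d →
    offset a b +ℤ d ≈ offset a′ b′ → At i a′ b′ y
  At-step {i} {a} {b} {a′} {b′} {x} {y} d (at x≈) y≈x+d moved = at (begin
    ι y                          ≈⟨ y≈x+d ⟩
    ι x +ℤ d                     ≈⟨ +-congʳ d x≈ ⟩
    (ι i +ℤ offset a b) +ℤ d     ≡⟨ ℤₚ.+-assoc (ι i) (offset a b) d ⟩
    ι i +ℤ (offset a b +ℤ d)     ≈⟨ +-congˡ (ι i) moved ⟩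
    ι i +ℤ offset a′ b′          ∎)
    where open ≈-Reasoning

  At-back : ∀ {i a b a′ b′ x y} d → At i a b y → ι y ≈ ι x +ℤ d →
    offset a′ b′ +ℤ d ≈ offset a b → At i a′ b′ x
  At-back {i} {a} {b} {a′} {b′} {x} {y} d (at y≈) y≈x+d moved = at (+-cancelʳ d (begin
    ι x +ℤ d                     ≈⟨ ≈-sym y≈x+d ⟩
    ι y                          ≈⟨ y≈ ⟩
    ι i +ℤ offset a b            ≈⟨ +-congˡ (ι i) (≈-sym moved) ⟩
    ι i +ℤ (offset a′ b′ +ℤ d)   ≡⟨ ℤₚ.+-assoc (ι i) (offset a′ b′) d ⟨
    (ι i +ℤ offset a′ b′) +ℤ d   ∎))
    where open ≈-Reasoning

  At-edge : ∀ {i a b a′ b′ x y} d → At i a b x → At i a′ b′ y →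
    offset a b +ℤ d ≈ offset a′ b′ → ι y ≈ ι x +ℤ d
  At-edge {i} {a} {b} {a′} {b′} {x} {y} d (at x≈) (at y≈) moved = begin
    ι y                          ≈⟨ y≈ ⟩
    ι i +ℤ offset a′ b′          ≈⟨ +-congˡ (ι i) (≈-sym moved) ⟩
    ι i +ℤ (offset a b +ℤ d)     ≡⟨ ℤₚ.+-assoc (ι i) (offset a b) d ⟨
    (ι i +ℤ offset a b) +ℤ d     ≈⟨ +-congʳ d (≈-sym x≈) ⟩
    ι x +ℤ d                     ∎
    where open ≈-Reasoning

  data Spoke : Set where
    r-spoke s-spoke : Spoke

  jump : Spoke → ℕ
  jump r-spoke = toℕ r
  jump s-spoke = toℕ s

  -- the change of the r-coordinate along a spoke (s ≡ 3r)
  weight : Spoke → ℤ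
  weight r-spoke = + 1
  weight s-spoke = + 3

  jump≈ : ∀ c → + jump c ≈ weight c *ℤ R
  jump≈ r-spoke = ≈-reflexive (sym (ℤₚ.*-identityˡ R))
  jump≈ s-spoke = s≈3r

  jump<n : ∀ c → jump c < n
  jump<n r-spoke = toℕ<n r
  jump<n s-spoke = toℕ<n s

  k<n : k < n
  k<n = subst (k <_) (ℕₚ.*-comm k 2) (ℕₚ.m<m*n k 2 (s≤s (s≤s z≤n)))

  offset-spoke : ∀ a b c → offset a b +ℤ + jump c ≈ offset a (b +ℤ weight c)
  offset-spoke a b c = begin
    offset a b +ℤ + jump c          ≈⟨ +-congˡ (offset a b) (jump≈ c) ⟩
    offset a b +ℤ weight c *ℤ R     ≡⟨ regroup a b (weight c) K R ⟩
    offset a (b +ℤ weight c)        ∎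
    where
    open ≈-Reasoning
    regroup : ∀ a b w K R → (a *ℤ K +ℤ b *ℤ R) +ℤ w *ℤ R ≡ a *ℤ K +ℤ (b +ℤ w) *ℤ R
    regroup = solve-∀

  offset-spoke⁻ : ∀ a b c → offset a (b -ℤ weight c) +ℤ + jump c ≈ offset a b
  offset-spoke⁻ a b c = begin
    offset a (b -ℤ weight c) +ℤ + jump c    ≈⟨ offset-spoke a (b -ℤ weight c) c ⟩
    offset a (b -ℤ weight c +ℤ weight c)    ≡⟨ cong (offset a) (cancel b (weight c)) ⟩
    offset a b                              ∎
    where
    open ≈-Reasoning
    cancel : ∀ b w → b -ℤ w +ℤ w ≡ b
    cancel = solve-∀

  offset-uu : ∀ a b → offset a b +ℤ K ≈ offset (a +ℤ 1ℤ) b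
  offset-uu a b = ≈-reflexive (regroup a b K R)
    where
    regroup : ∀ a b K R → (a *ℤ K +ℤ b *ℤ R) +ℤ K ≡ (a +ℤ 1ℤ) *ℤ K +ℤ b *ℤ R
    regroup = solve-∀

  -- since 2k ≡ 0, a u–u edge also subtracts 1 from the k-coordinate
  offset-uu⁻ : ∀ a b → offset (a +ℤ 1ℤ) b +ℤ K ≈ offset a b
  offset-uu⁻ a b = begin
    offset (a +ℤ 1ℤ) b +ℤ K         ≡⟨ regroup a b K R ⟩
    offset a b +ℤ + 2 *ℤ K          ≈⟨ +-congˡ (offset a b) 2k≈0 ⟩
    offset a b +ℤ 0ℤ                ≡⟨ ℤₚ.+-identityʳ (offset a b) ⟩
    offset a b                      ∎
    where
    open ≈-Reasoning
    regroup : ∀ a b K R → ((a +ℤ 1ℤ) *ℤ K +ℤ b *ℤ R) +ℤ K ≡ (a *ℤ K +ℤ b *ℤ R) +ℤ + 2 *ℤ K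
    regroup = solve-∀

  At-spoke : ∀ {i a b x y} c → At i a b x → AddEq n x (jump c) y → At i a (b +ℤ weight c) y
  At-spoke {a = a} {b} {x} {y} c p e =
    At-step (+ jump c) p (AddEq⇒≈ {x} {jump c} {y} e) (offset-spoke a b c)

  At-spoke⁻ : ∀ {i a b x y} c → At i a b y → AddEq n x (jump c) y → At i a (b -ℤ weight c) x
  At-spoke⁻ {a = a} {b} {x} {y} c p e =
    At-back (+ jump c) p (AddEq⇒≈ {x} {jump c} {y} e) (offset-spoke⁻ a b c)

  At-uu : ∀ {i a b x y} → At i a b x → AddEq n x k y → At i (a +ℤ 1ℤ) b y
  At-uu {a = a} {b} {x} {y} p e = At-step K p (AddEq⇒≈ {x} {k} {y} e) (offset-uu a b)

  spoke-edge : ∀ {i a b x y} c → At i a b x → At i a (b +ℤ weight c) y → AddEq n x (jump c) y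
  spoke-edge {a = a} {b} c p q =
    ≈⇒AddEq (jump<n c) (At-edge (+ jump c) p q (offset-spoke a b c))

  spoke-edge⁻ : ∀ {i a b x y} c → At i a (b -ℤ weight c) x → At i a b y → AddEq n x (jump c) y
  spoke-edge⁻ {a = a} {b} c p q =
    ≈⇒AddEq (jump<n c) (At-edge (+ jump c) p q (offset-spoke⁻ a b c))

  uu-edge : ∀ {i a b x y} → At i a b x → At i (a +ℤ 1ℤ) b y → AddEq n x k y
  uu-edge {a = a} {b} p q = ≈⇒AddEq k<n (At-edge K p q (offset-uu a b))

  uu-edge⁻ : ∀ {i a b x y} → At i (a +ℤ 1ℤ) b x → At i a b y → AddEq n x k y
  uu-edge⁻ {a = a} {b} p q = ≈⇒AddEq k<n (At-edge K p q (offset-uu⁻ a b))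

  short : ℤ → Bool
  short b = (1 ≤ᵇ ∣ b ∣) ∧ (∣ b ∣ ≤ᵇ 8)

  -- The key obstruction: a·k + b·r ≢ 0 (mod 2k) for short b.  Otherwise
  -- k ∣ b·r, so k ∣ b as gcd(k, r) = 1, contradicting 0 < |b| ≤ 8 < k.
  no-short-relation : ∀ a b → T (short b) → ¬ (+ n ∣ℤ offset a b)
  no-short-relation a b short-b n∣offset =
    ℕₚ.<⇒≱ (ℕₚ.<-≤-trans (s≤s |b|≤8) 9≤k) (ℕ∣.∣⇒≤ {{ℕ.>-nonZero 1≤|b|}} k∣|b|)
    where
    bounds : T (1 ≤ᵇ ∣ b ∣) × T (∣ b ∣ ≤ᵇ 8)
    bounds = Equivalence.to T-∧ short-b
    1≤|b| : 1 ≤ ∣ b ∣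
    1≤|b| = ℕₚ.≤ᵇ⇒≤ 1 ∣ b ∣ (proj₁ bounds)
    |b|≤8 : ∣ b ∣ ≤ 8
    |b|≤8 = ℕₚ.≤ᵇ⇒≤ ∣ b ∣ 8 (proj₂ bounds)
    K∣bR : K ∣ℤ b *ℤ R
    K∣bR = ∣m+n∣m⇒∣n (∣-trans (divides (+ 2) (ℤₚ.pos-* 2 k)) n∣offset) (∣n⇒∣m*n a ∣-refl)
    k∣r|b| : k ∣ℕ toℕ r * ∣ b ∣
    k∣r|b| = subst (k ∣ℕ_) (trans (ℤₚ.abs-* b R) (ℕₚ.*-comm ∣ b ∣ (toℕ r))) (∣⇒∣ᵤ K∣bR)
    k∣|b| : k ∣ℕ ∣ b ∣
    k∣|b| = coprime-divisor coprime k∣r|b|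

  at-distinct : ∀ {i a b a′ b′ x y} → At i a b x → At i a′ b′ y →
    T (short (b′ -ℤ b)) → x ≢ y
  at-distinct {i} {a} {b} {a′} {b′} {x} (at ⟨ n∣x-p ⟩) (at ⟨ n∣x-q ⟩) short-db refl =
    no-short-relation (a′ -ℤ a) (b′ -ℤ b) short-db
      (subst (+ n ∣ℤ_) (difference (ι x) (ι i) a b a′ b′ K R) (∣m∣n⇒∣m-n n∣x-p n∣x-q))
    where
    difference : ∀ x i a b a′ b′ K R →
      (x -ℤ (i +ℤ (a *ℤ K +ℤ b *ℤ R))) -ℤ (x -ℤ (i +ℤ (a′ *ℤ K +ℤ b′ *ℤ R)))
        ≡ (a′ -ℤ a) *ℤ K +ℤ (b′ -ℤ b) *ℤ R
    difference = solve-∀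

  open Walks (Adj k r s)

  -- adjacency in T₁(k, r, s), read from the first vertex; case analysis on
  -- walks is done on Steps rather than on the unordered Adj of Defs
  data Step : Vertex k → Vertex k → Set where
    uu : ∀ {i j} → AddEq n i k j → Step (u i) (u j)
    uv : ∀ {i} → Step (u i) (v i)
    uw : ∀ {i} → Step (u i) (w i)
    vu : ∀ {i} → Step (v i) (u i)
    wu : ∀ {i} → Step (w i) (u i)
    vw : ∀ {i j} c → AddEq n i (jump c) j → Step (v i) (w j)
    wv : ∀ {i j} c → AddEq n j (jump c) i → Step (w i) (v j)

  -- i + k = j iff j + k = i, since 2k ≡ 0
  uu-sym : ∀ {i j} → AddEq n j k i → AddEq n i k j
  uu-sym {i} {j} e = uu-edge⁻ (At-uu (at-origin j) e) (at-origin j)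

  step : ∀ {x y} → Adj k r s x y → Step x y
  step (inj₁ (uu i j e))  = uu e
  step (inj₁ (uv i))      = uv
  step (inj₁ (uw i))      = uw
  step (inj₁ (vwr i j e)) = vw r-spoke e
  step (inj₁ (vws i j e)) = vw s-spoke e
  step (inj₂ (uu i j e))  = uu (uu-sym e)
  step (inj₂ (uv i))      = vu
  step (inj₂ (uw i))      = wu
  step (inj₂ (vwr i j e)) = wv r-spoke e
  step (inj₂ (vws i j e)) = wv s-spoke e

  adj : ∀ {x y} → Step x y → Adj k r s x y
  adj (uu e)         = inj₁ (uu _ _ e)
  adj uv             = inj₁ (uv _)
  adj uw             = inj₁ (uw _)
  adj vu             = inj₂ (uv _)
  adj wu             = inj₂ (uw _)
  adj (vw r-spoke e) = inj₁ (vwr _ _ e)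
  adj (vw s-spoke e) = inj₁ (vws _ _ e)
  adj (wv r-spoke e) = inj₂ (vwr _ _ e)
  adj (wv s-spoke e) = inj₂ (vws _ _ e)

  octagon : ∀ {y₀ y₁ y₂ y₃ y₄ y₅ y₆ y₇} →
    Step y₀ y₁ → Step y₁ y₂ → Step y₂ y₃ → Step y₃ y₄ →
    Step y₄ y₅ → Step y₅ y₆ → Step y₆ y₇ → Step y₇ y₀ →
    y₀ ≢ y₂ → y₁ ≢ y₃ → y₂ ≢ y₄ → y₃ ≢ y₅ → y₄ ≢ y₆ → y₅ ≢ y₇ → y₆ ≢ y₀ → y₇ ≢ y₁ →
    Closes y₀ y₁ y₂ y₃
  octagon s01 s12 s23 s34 s45 s56 s67 s70 d02 d13 d24 d35 d46 d57 d60 d71 =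
    _ , _ , _ , _ , record
      { a01 = adj s01 ; a12 = adj s12 ; a23 = adj s23 ; a34 = adj s34
      ; a45 = adj s45 ; a56 = adj s56 ; a67 = adj s67 ; a70 = adj s70
      ; d02 = d02 ; d13 = d13 ; d24 = d24 ; d35 = d35
      ; d46 = d46 ; d57 = d57 ; d60 = d60 ; d71 = d71 }

  -- Closing the 3-arcs at u_i.  Coordinates are relative to i, and ω is the
  -- weight of the spoke used; each octagon is listed by its vertices.
  close-from-uu : ∀ {i j y₂ y₃} → AddEq n i k j → Step (u j) y₂ → Step y₂ y₃ →
    u i ≢ y₂ → u j ≢ y₃ → Closes (u i) (u j) y₂ y₃
  close-from-uu {i} {j} e₁ (uu e₂) _ d₀₂ _ =
    ⊥-elim (d₀₂ (cong u (AddEq-functional j k (uu-sym {j} {i} e₁) e₂)))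
  close-from-uu e₁ uv vu _ d₁₃ = ⊥-elim (d₁₃ refl)
  close-from-uu e₁ uw wu _ d₁₃ = ⊥-elim (d₁₃ refl)
  -- u(0,0) u(1,0) v(1,0) w(1,ω) u(1,ω) u(0,ω) w(0,ω) v(0,0)
  close-from-uu {i} e₁ uv (vw {j = x} c e₃) d₀₂ d₁₃ =
    octagon (uu e₁) uv (vw c e₃) wu (uu (uu-edge⁻ p q)) uw (wv c (spoke-edge c (at-origin i) q)) vu
      d₀₂ d₁₃ (λ ()) (λ ()) (λ ()) (λ ()) (λ ()) (λ ())
    where
    p : At i (+ 1) (0ℤ +ℤ weight c) x
    p = At-spoke c (At-uu (at-origin i) e₁) e₃
    q : At i 0ℤ (0ℤ +ℤ weight c) (point i 0ℤ (0ℤ +ℤ weight c))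
    q = at-point i 0ℤ (0ℤ +ℤ weight c)
  -- u(0,0) u(1,0) w(1,0) v(1,-ω) u(1,-ω) u(0,-ω) v(0,-ω) w(0,0)
  close-from-uu {i} e₁ uw (wv {j = x} c e₃) d₀₂ d₁₃ =
    octagon (uu e₁) uw (wv c e₃) vu (uu (uu-edge⁻ p q)) uv (vw c (spoke-edge⁻ c q (at-origin i))) wu
      d₀₂ d₁₃ (λ ()) (λ ()) (λ ()) (λ ()) (λ ()) (λ ())
    where
    p : At i (+ 1) (0ℤ -ℤ weight c) x
    p = At-spoke⁻ c (At-uu (at-origin i) e₁) e₃
    q : At i 0ℤ (0ℤ -ℤ weight c) (point i 0ℤ (0ℤ -ℤ weight c))
    q = at-point i 0ℤ (0ℤ -ℤ weight c)

  close-from-uv : ∀ {i y₂ y₃} → Step (v i) y₂ → Step y₂ y₃ →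
    u i ≢ y₂ → v i ≢ y₃ → Closes (u i) (v i) y₂ y₃
  close-from-uv vu _ d₀₂ _ = ⊥-elim (d₀₂ refl)
  -- u(0,0) v(0,0) w(0,ω) u(0,ω) u(1,ω) w(1,ω) v(1,0) u(1,0)
  close-from-uv {i} (vw {j = x} c e₂) wu d₀₂ d₁₃ =
    octagon uv (vw c e₂) wu (uu (uu-edge p q)) uw (wv c (spoke-edge c o q)) vu (uu (uu-edge⁻ o (at-origin i)))
      d₀₂ d₁₃ (λ ()) (λ ()) (λ ()) (λ ()) (λ ()) (λ ())
    where
    p : At i 0ℤ (0ℤ +ℤ weight c) x
    p = At-spoke c (at-origin i) e₂
    q : At i (+ 1) (0ℤ +ℤ weight c) (point i (+ 1) (0ℤ +ℤ weight c))
    q = at-point i (+ 1) (0ℤ +ℤ weight c)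
    o : At i (+ 1) 0ℤ (point i (+ 1) 0ℤ)
    o = at-point i (+ 1) 0ℤ
  close-from-uv (vw {j = x} r-spoke e₂) (wv r-spoke e₃) _ d₁₃ =
    ⊥-elim (d₁₃ (cong v (AddEq-injective (toℕ r) x e₂ e₃)))
  close-from-uv (vw {j = x} s-spoke e₂) (wv s-spoke e₃) _ d₁₃ =
    ⊥-elim (d₁₃ (cong v (AddEq-injective (toℕ s) x e₂ e₃)))
  -- u(0,0) v(0,0) w(0,1) v(0,-2) w(0,-1) u(0,-1) v(0,-1) w(0,0)
  close-from-uv {i} (vw {j = x} r-spoke e₂) (wv {j = y} s-spoke e₃) d₀₂ d₁₃ =
    octagon uv (vw r-spoke e₂) (wv s-spoke e₃) (vw r-spoke (spoke-edge r-spoke p q)) wu uv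
      (vw r-spoke (spoke-edge r-spoke q (at-origin i))) wu
      d₀₂ d₁₃ (at-distinct w₁ q tt ∘ cong index) (λ ()) (λ ()) (λ ()) (λ ()) (λ ())
    where
    w₁ : At i 0ℤ (+ 1) x
    w₁ = At-spoke r-spoke (at-origin i) e₂
    p : At i 0ℤ -[1+ 1 ] y
    p = At-spoke⁻ s-spoke w₁ e₃
    q : At i 0ℤ -[1+ 0 ] (point i 0ℤ -[1+ 0 ])
    q = at-point i 0ℤ -[1+ 0 ]
  -- u(0,0) v(0,0) w(0,3) v(0,2) u(0,2) w(0,2) v(0,-1) w(0,0)
  close-from-uv {i} (vw s-spoke e₂) (wv {j = y} r-spoke e₃) d₀₂ d₁₃ =
    octagon uv (vw s-spoke e₂) (wv r-spoke e₃) vu uw (wv s-spoke (spoke-edge s-spoke q p))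
      (vw r-spoke (spoke-edge r-spoke q (at-origin i))) wu
      d₀₂ d₁₃ (λ ()) (λ ()) (λ ()) (at-distinct p (at-origin i) tt ∘ cong index) (λ ()) (λ ())
    where
    p : At i 0ℤ (+ 2) y
    p = At-spoke⁻ r-spoke (At-spoke s-spoke (at-origin i) e₂) e₃
    q : At i 0ℤ -[1+ 0 ] (point i 0ℤ -[1+ 0 ])
    q = at-point i 0ℤ -[1+ 0 ]

  close-from-uw : ∀ {i y₂ y₃} → Step (w i) y₂ → Step y₂ y₃ →
    u i ≢ y₂ → w i ≢ y₃ → Closes (u i) (w i) y₂ y₃
  close-from-uw wu _ d₀₂ _ = ⊥-elim (d₀₂ refl)
  -- u(0,0) w(0,0) v(0,-ω) u(0,-ω) u(1,-ω) v(1,-ω) w(1,0) u(1,0)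
  close-from-uw {i} (wv {j = x} c e₂) vu d₀₂ d₁₃ =
    octagon uw (wv c e₂) vu (uu (uu-edge p q)) uv (vw c (spoke-edge⁻ c q o)) wu (uu (uu-edge⁻ o (at-origin i)))
      d₀₂ d₁₃ (λ ()) (λ ()) (λ ()) (λ ()) (λ ()) (λ ())
    where
    p : At i 0ℤ (0ℤ -ℤ weight c) x
    p = At-spoke⁻ c (at-origin i) e₂
    q : At i (+ 1) (0ℤ -ℤ weight c) (point i (+ 1) (0ℤ -ℤ weight c))
    q = at-point i (+ 1) (0ℤ -ℤ weight c)
    o : At i (+ 1) 0ℤ (point i (+ 1) 0ℤ)
    o = at-point i (+ 1) 0ℤ
  close-from-uw (wv {j = x} r-spoke e₂) (vw r-spoke e₃) _ d₁₃ =
    ⊥-elim (d₁₃ (cong w (AddEq-functional x (toℕ r) e₂ e₃)))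
  close-from-uw (wv {j = x} s-spoke e₂) (vw s-spoke e₃) _ d₁₃ =
    ⊥-elim (d₁₃ (cong w (AddEq-functional x (toℕ s) e₂ e₃)))
  -- u(0,0) w(0,0) v(0,-1) w(0,2) v(0,1) u(0,1) w(0,1) v(0,0)
  close-from-uw {i} (wv {j = x} r-spoke e₂) (vw {j = y} s-spoke e₃) d₀₂ d₁₃ =
    octagon uw (wv r-spoke e₂) (vw s-spoke e₃) (wv r-spoke (spoke-edge r-spoke q p)) vu uw
      (wv r-spoke (spoke-edge r-spoke (at-origin i) q)) vu
      d₀₂ d₁₃ (at-distinct v₁ q tt ∘ cong index) (λ ()) (λ ()) (λ ()) (λ ()) (λ ())
    where
    v₁ : At i 0ℤ -[1+ 0 ] x
    v₁ = At-spoke⁻ r-spoke (at-origin i) e₂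
    p : At i 0ℤ (+ 2) y
    p = At-spoke s-spoke v₁ e₃
    q : At i 0ℤ (+ 1) (point i 0ℤ (+ 1))
    q = at-point i 0ℤ (+ 1)
  -- u(0,0) w(0,0) v(0,-3) w(0,-2) u(0,-2) v(0,-2) w(0,1) v(0,0)
  close-from-uw {i} (wv s-spoke e₂) (vw {j = y} r-spoke e₃) d₀₂ d₁₃ =
    octagon uw (wv s-spoke e₂) (vw r-spoke e₃) wu uv (vw s-spoke (spoke-edge s-spoke p q))
      (wv r-spoke (spoke-edge r-spoke (at-origin i) q)) vu
      d₀₂ d₁₃ (λ ()) (λ ()) (λ ()) (at-distinct p (at-origin i) tt ∘ cong index) (λ ()) (λ ())
    where
    p : At i 0ℤ -[1+ 1 ] y
    p = At-spoke r-spoke (At-spoke⁻ s-spoke (at-origin i) e₂) e₃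
    q : At i 0ℤ (+ 1) (point i 0ℤ (+ 1))
    q = at-point i 0ℤ (+ 1)

  u-arcs-close : ∀ i → ArcsClose (u i)
  u-arcs-close i arc = close-from-u (step a01) (step a12) (step a23) d02 d13
    where
    open Arc arc
    close-from-u : ∀ {y₁ y₂ y₃} → Step (u i) y₁ → Step y₁ y₂ → Step y₂ y₃ →
      u i ≢ y₂ → y₁ ≢ y₃ → Closes (u i) y₁ y₂ y₃
    close-from-u (uu e₁) = close-from-uu e₁
    close-from-u uv      = close-from-uv
    close-from-u uw      = close-from-uw

  -- Boolean conditions on m spoke kinds, verified by evaluating all 2^m cases
  Condition : ℕ → Set
  Condition zero    = Bool
  Condition (suc m) = Spoke → Condition m

  every : ∀ m → Condition m → Bool
  every zero    b = b
  every (suc m) f = every m (f r-spoke) ∧ every m (f s-spoke)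

  Holds : ∀ m → Condition m → Set
  Holds zero    b = T b
  Holds (suc m) f = ∀ c → Holds m (f c)

  every-sound : ∀ m f → T (every m f) → Holds m f
  every-sound zero    b t         = t
  every-sound (suc m) f t r-spoke = every-sound m (f r-spoke) (proj₁ (Equivalence.to T-∧ t))
  every-sound (suc m) f t s-spoke = every-sound m (f s-spoke) (proj₂ (Equivalence.to T-∧ t))

  -- The r-coordinate differences met in v-arc-open: |ω₁ + ω₅| ∈ {2, 4, 6},
  -- and ω₅ - ω₄ + ω₃ - ω₂ + ω₁ is odd and lies between -3 and 7.
  short-return₂ : ∀ c₁ c₅ → T (short ((0ℤ +ℤ weight c₅) -ℤ (0ℤ -ℤ weight c₁)))
  short-return₂ = every-sound 2 (λ c₁ c₅ → short ((0ℤ +ℤ weight c₅) -ℤ (0ℤ -ℤ weight c₁))) tt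

  return₅ : Spoke → Spoke → Spoke → Spoke → Spoke → ℤ
  return₅ c₁ c₂ c₃ c₄ c₅ =
    (0ℤ +ℤ weight c₅) -ℤ ((((0ℤ -ℤ weight c₁) +ℤ weight c₂) -ℤ weight c₃) +ℤ weight c₄)

  short-return₅ : ∀ c₁ c₂ c₃ c₄ c₅ → T (short (return₅ c₁ c₂ c₃ c₄ c₅))
  short-return₅ = every-sound 5 (λ c₁ c₂ c₃ c₄ c₅ → short (return₅ c₁ c₂ c₃ c₄ c₅)) tt

  -- With v_i at (0,0),
  -- w_j is at (1,0), and a closing walk w_j y₄ y₅ y₆ y₇ v_i that does not
  -- backtrack either passes along u–u once more or zigzags along five
  -- spokes; either way its end is a point at two positions whose
  -- r-coordinates differ by a short amount.
  v-arc-open : ∀ {i j} → AddEq n i k j → ¬ Closes (v i) (u i) (u j) (w j)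
  v-arc-open {i} {j} e (_ , _ , _ , _ , oct) =
    returns (step a34) (step a45) (step a56) (step a67) (step a70) d24 d46 d57 d71
    where
    open Octagon oct
    wj : At i (+ 1) 0ℤ j
    wj = At-uu (at-origin i) e
    returns : ∀ {y₄ y₅ y₆ y₇} →
      Step (w j) y₄ → Step y₄ y₅ → Step y₅ y₆ → Step y₆ y₇ → Step y₇ (v i) →
      u j ≢ y₄ → y₄ ≢ y₆ → y₅ ≢ y₇ → y₇ ≢ u i → ⊥
    returns wu _ _ _ _ d₂₄ _ _ _ = d₂₄ refl
    returns _ _ _ _ uv _ _ _ d₇₁ = d₇₁ refl
    returns (wv c₁ e₁) vu uv _ _ _ d₄₆ _ _ = d₄₆ refl
    returns (wv c₁ e₁) vu (uu e₃) uw (wv c₅ e₅) _ _ _ _ =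
      at-distinct (At-uu (At-spoke⁻ c₁ wj e₁) e₃) (At-spoke c₅ (at-origin i) e₅)
        (short-return₂ c₁ c₅) refl
    returns (wv c₁ e₁) (vw c₂ e₂) wu uw _ _ _ d₅₇ _ = d₅₇ refl
    returns (wv c₁ e₁) (vw c₂ e₂) (wv c₃ e₃) (vw c₄ e₄) (wv c₅ e₅) _ _ _ _ =
      at-distinct (At-spoke c₄ (At-spoke⁻ c₃ (At-spoke c₂ (At-spoke⁻ c₁ wj e₁) e₂) e₃) e₄)
        (At-spoke c₅ (at-origin i) e₅) (short-return₅ c₁ c₂ c₃ c₄ c₅) refl

  v-arcs-open : ∀ i → ¬ ArcsClose (v i)
  v-arcs-open i arcs-close = v-arc-open i+k=j (arcs-close (record
    { a01 = inj₂ (uv i) ; a12 = inj₁ (uu i j i+k=j) ; a23 = inj₁ (uw j)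
    ; d02 = λ () ; d13 = λ () }))
    where
    j : Fin n
    j = point i (+ 1) 0ℤ
    i+k=j : AddEq n i k j
    i+k=j = uu-edge (at-origin i) (at-point i (+ 1) 0ℤ)

-- An automorphism taking v_i to u_i would make every 3-arc at v_i close,
-- as every 3-arc at u_i does.
lemma4p9 : (k : ℕ) → 9 ≤ k → (r s : Fin (2 * k)) → r ≢ s → Connected k r s
    → (∃ λ q → 3 * toℕ r ≡ toℕ s + q * (2 * k))
    → ¬ VertexTransitive k r s
lemma4p9 k 9≤k r s _ connected (q , 3r≡s+qn) transitive =
  let σ , σ-automorphism , σvᵢ≡uᵢ = transitive (v i) (u i)
  in v-arcs-open i (arcsClose-reflect σ σ-automorphism (v i)
       (subst ArcsClose (sym σvᵢ≡uᵢ) (u-arcs-close i)))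
  where
  instance
    k≢0 : NonZero k
    k≢0 = ℕ.>-nonZero (ℕₚ.<-≤-trans (s≤s z≤n) 9≤k)
  open Congruence (2 * k) using (_≈_; ≈-sym; ≈-trans; ≈-reflexive; ℕ-≈; reduce)
  s≈3r : + toℕ s ≈ + 3 *ℤ + toℕ r
  s≈3r = ≈-sym (≈-trans (≈-reflexive (sym (ℤₚ.pos-* 3 (toℕ r)))) (ℕ-≈ q 3r≡s+qn))
  open Geometry k 9≤k r s (connected⇒coprime k r s q 3r≡s+qn connected) s≈3r
  open Walks (Adj k r s) using (ArcsClose; arcsClose-reflect)
  i : Fin (2 * k)
  i = proj₁ (reduce 0ℤ)
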